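{- Let $\Sigma$ be an alphabet of size $\sigma \ge 2$ and $d$ a positive integer with $\sigma \le d$. If $n - d \in \Omega(n)$ (i.e. $n-d \ge cn$ for a constant $c>0$), then there exist strings $T$ of length $n > d$ over $\Sigma$ with $\mathcal{S}(T,d) \in \Omega(\sigma n)$. (That is, the known upper bound $\mathcal{S}(T,d) \in O(\sigma n)$ is tight in this regime.)
   Context: For a string $W$, $W[a..b]$ denotes the substring from position $a$ to position $b$. A string $w$ is present in $W$ if it occurs in $W$ (the empty string is always present) and absent otherwise. A string $w\in\Sigma^\ast$ is a minimal absent word (MAW) of $W$ if $w$ is absent from $W$ and every proper substring of $w$ is present in $W$; $\mathsf{MAW}(W)$ is the set of all MAWs of $W$. For a string $T$ of length $n>d$, $\mathcal{S}(T,d) = \sum_{i=1}^{n-d} |\mathsf{MAW}(T[i..i+d-1]) \bigtriangleup \mathsf{MAW}(T[i+1..i+d])|$, with $\bigtriangleup$ symmetric difference. -}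

module Defs where

open import Data.Bool using (Bool; true; false; not; _∧_; _xor_; if_then_else_)
open import Data.Nat using (ℕ; zero; suc; _+_; _∸_; _<ᵇ_)
open import Data.Fin using (Fin)
import Data.Fin as Fin
open import Data.List using (List; []; _∷_; length; take; drop; map; concatMap; upTo; allFin; filter)
open import Data.Nat.ListAction using (sum)
open import Data.Bool.ListAction using (all)
open import Relation.Nullary using (does)
open import Relation.Binary.PropositionalEquality using (_≡_)
open import Data.List.Relation.Binary.Infix.Heterogeneous using (Infix)
open import Data.List.Relation.Binary.Infix.Heterogeneous.Properties using (infix?)
open import Data.Bool.Properties using (T?)

Word : ℕ → Set
Word σ = List (Fin σ)

Present : {σ : ℕ} → Word σ → Word σ → Set
Present w W = Infix _≡_ w W

present? : {σ : ℕ} → Word σ → Word σ → Bool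
present? w W = does (infix? Fin._≟_ w W)

substrings : {σ : ℕ} → Word σ → List (Word σ)
substrings w = concatMap (λ i → map (λ k → take k (drop i w)) (upTo (suc (length w))))
                         (upTo (suc (length w)))

-- w is a minimal absent word of W: w is absent from W and every proper
-- substring of w (substring of strictly smaller length) is present in W.
isMAW : {σ : ℕ} → Word σ → Word σ → Bool
isMAW w W = not (present? w W)
            ∧ all (λ u → if length u <ᵇ length w then present? u W else true) (substrings w)

wordsOfLength : (σ : ℕ) → ℕ → List (Word σ)
wordsOfLength σ zero    = [] ∷ []
wordsOfLength σ (suc m) = concatMap (λ a → map (a ∷_) (wordsOfLength σ m)) (allFin σ)

wordsUpTo : (σ : ℕ) → ℕ → List (Word σ)
wordsUpTo σ L = concatMap (wordsOfLength σ) (upTo (suc L))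

-- |MAW(x) △ MAW(y)|.  A MAW of W has length ≤ |W| + 1, so every element of
-- MAW(x) ∪ MAW(y) has length ≤ |x| + |y| + 1 and is enumerated exactly once.
symDiffMAW : {σ : ℕ} → Word σ → Word σ → ℕ
symDiffMAW {σ} x y =
  length (filter (λ w → T? (isMAW w x xor isMAW w y)) (wordsUpTo σ (length x + length y + 1)))

-- Substring T[i..i+d-1] (1-based i) is  window T (i-1) d.
window : {σ : ℕ} → Word σ → ℕ → ℕ → Word σ
window T j d = take d (drop j T)

-- S(T,d) = Σ_{i=1}^{n-d} |MAW(T[i..i+d-1]) △ MAW(T[i+1..i+d])|, n = |T|
-- (written with 0-based j = i - 1 ranging over 0 … n-d-1).
S : {σ : ℕ} → Word σ → ℕ → ℕ
S T d = sum (map (λ j → symDiffMAW (window T j d) (window T (suc j) d)) (upTo (length T ∸ d)))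

module Submission where

-- Write σ = m + 1 and K = ⌈d / m⌉.  The text carries a marker every K positions, the markers
-- cycling through the m non-filler letters, and the filler letter 0 elsewhere; a window of
-- length d ≤ m K holds about d / K > m / 2 markers, all distinct.  When the window slides
-- to within r + 1 ≤ K / 2 positions of its first marker c, the word 0^(r+1) c leaves the
-- window and becomes a MAW, while each b 0^(r+1) c, for b a later marker in the window,
-- ceases to be one: Ω(σ) changes in a single step.  Since this happens for at least a third
-- of the n - d steps, S(T, d) ≥ (n - d) σ / 6.

open import Defs
open import Data.Bool using (true; false; not; _∧_; _xor_; T; if_then_else_)
open import Data.Bool.ListAction using (all)
open import Data.Bool.Properties using (T?; T-≡; ¬-not; ∧-zeroʳ)
open import Data.Empty using (⊥-elim)
open import Data.Fin using (Fin; toℕ)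
open import Data.Fin.Properties using (toℕ-fromℕ<) renaming (suc-injective to fsuc-injective)
import Data.Fin as Fin
open import Data.List using (List; []; _∷_; [_]; _++_; length; take; drop; map; upTo; applyUpTo; replicate)
open import Data.List.Properties
  using (++-assoc; take++drop≡id; take-all; length-++; length-++-≤ʳ; length-removeAt′; length-replicate;
         length-applyUpTo; ∷-injectiveˡ; ∷-injectiveʳ)
open import Data.List.Membership.Propositional using (_∈_; lose)
open import Data.List.Membership.Propositional.Properties
  using (∈-map⁺; ∈-map⁻; ∈-concatMap⁺; ∈-concatMap⁻; ∈-upTo⁺; ∈-allFin; ∈-filter⁺; ∈-applyUpTo⁻)
open import Data.List.Relation.Unary.Any using (here; there; satisfied; _─_)
import Data.List.Relation.Unary.All as All
open import Data.List.Relation.Unary.All.Properties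
  using (all⁺; all⁻) renaming (applyUpTo⁺₁ to All-applyUpTo⁺₁)
open import Data.List.Relation.Unary.AllPairs using (_∷_)
open import Data.List.Relation.Unary.Unique.Propositional using (Unique)
open import Data.List.Relation.Unary.Unique.Propositional.Properties
  using () renaming (applyUpTo⁺₁ to Unique-applyUpTo⁺₁)
open import Data.List.Relation.Binary.Infix.Heterogeneous using (MkView; toView; fromView)
open import Data.List.Relation.Binary.Infix.Heterogeneous.Properties using (infix?)
open import Data.List.Relation.Binary.Pointwise using (Pointwise-≡⇒≡; ≡⇒Pointwise-≡)
open import Data.Nat
  using (ℕ; zero; suc; pred; _+_; _*_; _∸_; _≤_; _<_; z≤n; s≤s; z<s; s<s; _<ᵇ_; NonZero; >-nonZero; >-nonZero⁻¹)
open import Data.Nat.DivMod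
  using (_/_; _%_; _mod_; m≡m%n+[m/n]*n; m*n/n≡m; m/n*n≡m; m/n*n≤m; m%n<n; m<n⇒m%n≡m; [m+n]%n≡m%n; m≥n⇒m/n>0)
open import Data.Nat.Induction using (<-rec)
open import Data.Nat.ListAction using (sum)
open import Data.Nat.Divisibility using (_∣_; _∣?_; >⇒∤; ∣m+n∣m⇒∣n; n∣m*n)
open import Data.Nat.Properties
open import Data.Nat.Tactic.RingSolver using (solve-∀)
open import Data.Product using (∃; ∃₂; _×_; _,_; proj₁; proj₂)
open import Function using (_∘′_; Equivalence)
open import Level using (Level)
open import Relation.Nullary using (¬_; yes; no; contradiction)
open import Relation.Binary.Definitions using (tri<; tri≈; tri>)
open import Relation.Nullary.Decidable using (dec-true; dec-false)
open import Relation.Binary.PropositionalEquality hiding ([_])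

private
  variable
    ℓ : Level
    A : Set ℓ
    σ : ℕ

Occurs : List A → List A → Set _
Occurs w W = ∃₂ λ u v → W ≡ u ++ w ++ v

Present⇒Occurs : {w W : Word σ} → Present w W → Occurs w W
Present⇒Occurs p with MkView u eq v ← toView p with refl ← Pointwise-≡⇒≡ eq = u , v , refl

Occurs⇒Present : {w W : Word σ} → Occurs w W → Present w W
Occurs⇒Present (u , v , refl) = fromView (MkView u (≡⇒Pointwise-≡ refl) v)

present?-occurs : {w W : Word σ} → Occurs w W → present? w W ≡ true
present?-occurs p = dec-true (infix? Fin._≟_ _ _) (Occurs⇒Present p)

present?-absent : {w W : Word σ} → ¬ Occurs w W → present? w W ≡ false
present?-absent ¬p = dec-false (infix? Fin._≟_ _ _) (¬p ∘′ Present⇒Occurs)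

Occurs-trans : {w v W : List A} → Occurs w v → Occurs v W → Occurs w W
Occurs-trans {w = w} (a , b , refl) (c , e , refl) = c ++ a , b ++ e , (begin
  c ++ (a ++ w ++ b) ++ e   ≡⟨ cong (c ++_) (trans (++-assoc a (w ++ b) e) (cong (a ++_) (++-assoc w b e))) ⟩
  c ++ a ++ w ++ b ++ e     ≡⟨ ++-assoc c a _ ⟨
  (c ++ a) ++ w ++ b ++ e   ∎)
  where open ≡-Reasoning

take-drop-occurs : ∀ i k (W : List A) → Occurs (take k (drop i W)) W
take-drop-occurs i k W = take i W , drop k (drop i W) ,
  trans (sym (take++drop≡id i W)) (cong (take i W ++_) (sym (take++drop≡id k (drop i W))))

private
  factorsAt : Word σ → ℕ → List (Word σ)
  factorsAt w i = map (λ k → take k (drop i w)) (upTo (suc (length w)))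

∈-substrings⁻ : {s w : Word σ} → s ∈ substrings w → ∃₂ λ i k → s ≡ take k (drop i w)
∈-substrings⁻ {w = w} s∈
  with i , s∈ᵢ ← satisfied (∈-concatMap⁻ (factorsAt w) {xs = upTo (suc (length w))} s∈)
  with k , _ , refl ← ∈-map⁻ (λ k → take k (drop i w)) {xs = upTo (suc (length w))} s∈ᵢ = i , k , refl

∈-substrings⁺ : ∀ {i k} (w : Word σ) → i ≤ length w → k ≤ length w → take k (drop i w) ∈ substrings w
∈-substrings⁺ {i = i} w i≤ k≤ =
  ∈-concatMap⁺ (factorsAt w) (lose (∈-upTo⁺ (s≤s i≤)) (∈-map⁺ (λ k → take k (drop i w)) (∈-upTo⁺ (s≤s k≤))))

take-++ˡ : ∀ k (xs ys : List A) → k ≤ length xs → take k (xs ++ ys) ≡ take k xs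
take-++ˡ zero    xs       ys _         = refl
take-++ˡ (suc k) (x ∷ xs) ys (s≤s k≤) = cong (x ∷_) (take-++ˡ k xs ys k≤)

length-take<⇒< : ∀ k (xs : List A) → length (take k xs) < length xs → k < length xs
length-take<⇒< zero    (x ∷ xs) _         = s≤s z≤n
length-take<⇒< (suc k) (x ∷ xs) (s≤s lt) = s≤s (length-take<⇒< k xs lt)

isMAW-present : ∀ (w W : Word σ) → Occurs w W → isMAW w W ≡ false
isMAW-present w W occ rewrite present?-occurs occ = refl

-- A word a v c is a MAW as soon as it is absent and its longest proper prefix a v and
-- suffix v c are present: every other proper factor is a factor of one of these two.
isMAW-intro : ∀ a (v : Word σ) c W → ¬ Occurs (a ∷ v ++ [ c ]) W →
              Occurs (a ∷ v) W → Occurs (v ++ [ c ]) W → isMAW (a ∷ v ++ [ c ]) W ≡ true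
isMAW-intro a v c W absent prefix suffix rewrite present?-absent absent =
  Equivalence.to T-≡ (all⁻ P (All.tabulate proper-factors-present))
  where
  w = a ∷ v ++ [ c ]
  P = λ u → if length u <ᵇ length w then present? u W else true

  length-w : length w ≡ suc (length (a ∷ v))
  length-w = trans (length-++ (a ∷ v)) (+-comm (length (a ∷ v)) 1)

  factor-occurs : ∀ i k → length (take k (drop i w)) < length w → Occurs (take k (drop i w)) W
  factor-occurs zero    k lt = Occurs-trans
    (subst (λ u → Occurs u (a ∷ v)) (sym (take-++ˡ k (a ∷ v) [ c ] k≤)) (take-drop-occurs 0 k (a ∷ v)))
    prefix
    where
    k≤ : k ≤ length (a ∷ v)
    k≤ = ≤-pred (subst (k <_) length-w (length-take<⇒< k w lt))
  factor-occurs (suc i) k lt = Occurs-trans (take-drop-occurs i k (v ++ [ c ])) suffix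

  proper-factors-present : ∀ {s} → s ∈ substrings w → T (P s)
  proper-factors-present s∈ with i , k , refl ← ∈-substrings⁻ {w = w} s∈
                            with length (take k (drop i w)) <ᵇ length w in lt
  ... | true  = Equivalence.from T-≡ (present?-occurs (factor-occurs i k (<ᵇ⇒< _ _ (subst T (sym lt) _))))
  ... | false = _

isMAW-absent-tail : ∀ a (v : Word σ) W → ¬ Occurs v W → isMAW (a ∷ v) W ≡ false
isMAW-absent-tail a v W absent = trans (cong (not (present? (a ∷ v) W) ∧_) all-false) (∧-zeroʳ _)
  where
  P = λ u → if length u <ᵇ length (a ∷ v) then present? u W else true

  tail∈ : take (length v) (drop 1 (a ∷ v)) ∈ substrings (a ∷ v)
  tail∈ = ∈-substrings⁺ (a ∷ v) (s≤s z≤n) (n≤1+n _)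

  tail-not-present : ¬ T (P (take (length v) v))
  tail-not-present
    rewrite take-all (length v) v ≤-refl
          | Equivalence.to T-≡ (<⇒<ᵇ (n<1+n (length v)))
          | present?-absent absent = λ ()

  all-false : all P (substrings (a ∷ v)) ≡ false
  all-false = ¬-not λ eq → tail-not-present (All.lookup (all⁺ P _ (Equivalence.from T-≡ eq)) tail∈)

∈-─⁺ : ∀ {x y : A} {xs} (x∈ : x ∈ xs) → y ∈ xs → y ≢ x → y ∈ (xs ─ x∈)
∈-─⁺ (here refl) (here refl) y≢x = ⊥-elim (y≢x refl)
∈-─⁺ (here refl) (there y∈)  _   = y∈
∈-─⁺ (there x∈)  (here refl) _   = here refl
∈-─⁺ (there x∈)  (there y∈)  y≢x = there (∈-─⁺ x∈ y∈ y≢x)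

Unique-⊆⇒length≤ : ∀ {xs ys : List A} → Unique xs → (∀ {x} → x ∈ xs → x ∈ ys) → length xs ≤ length ys
Unique-⊆⇒length≤ {xs = []}     _        _     = z≤n
Unique-⊆⇒length≤ {xs = x ∷ xs} {ys} (x∉ ∷ u) xs⊆ys = begin
  suc (length xs)                       ≤⟨ s≤s (Unique-⊆⇒length≤ u xs⊆ys─x) ⟩
  suc (length (ys ─ xs⊆ys (here refl))) ≡⟨ length-removeAt′ ys _ ⟨
  length ys                             ∎
  where
  open ≤-Reasoning
  xs⊆ys─x : ∀ {y} → y ∈ xs → y ∈ (ys ─ xs⊆ys (here refl))
  xs⊆ys─x y∈ = ∈-─⁺ (xs⊆ys (here refl)) (xs⊆ys (there y∈)) (λ y≡x → All.lookup x∉ y∈ (sym y≡x))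

∈-wordsOfLength : ∀ (w : Word σ) → w ∈ wordsOfLength σ (length w)
∈-wordsOfLength     []      = here refl
∈-wordsOfLength {σ} (a ∷ w) = ∈-concatMap⁺ (λ b → map (b ∷_) (wordsOfLength σ (length w)))
  (lose (∈-allFin a) (∈-map⁺ (a ∷_) (∈-wordsOfLength w)))

∈-wordsUpTo : ∀ {w : Word σ} {L} → length w ≤ L → w ∈ wordsUpTo σ L
∈-wordsUpTo {σ} {w} w≤L = ∈-concatMap⁺ (wordsOfLength σ) (lose (∈-upTo⁺ (s≤s w≤L)) (∈-wordsOfLength w))

symDiffMAW-≥ : ∀ (x y : Word σ) {ws} → Unique ws →
               (∀ {w} → w ∈ ws → length w ≤ length x + length y + 1) →
               (∀ {w} → w ∈ ws → T (isMAW w x xor isMAW w y)) →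
               length ws ≤ symDiffMAW x y
symDiffMAW-≥ {σ} x y u short differ = Unique-⊆⇒length≤ u λ w∈ →
  ∈-filter⁺ (λ w → T? (isMAW w x xor isMAW w y)) (∈-wordsUpTo (short w∈)) (differ w∈)

slice : (ℕ → A) → ℕ → ℕ → List A
slice f a zero    = []
slice f a (suc l) = f a ∷ slice f (suc a) l

module _ (f : ℕ → A) where

  length-slice : ∀ s l → length (slice f s l) ≡ l
  length-slice s zero    = refl
  length-slice s (suc l) = cong suc (length-slice (suc s) l)

  drop-slice : ∀ j s l → drop j (slice f s l) ≡ slice f (s + j) (l ∸ j)
  drop-slice zero    s l       rewrite +-identityʳ s = refl
  drop-slice (suc j) s zero    = refl
  drop-slice (suc j) s (suc l) rewrite +-suc s j = drop-slice j (suc s) l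

  take-slice : ∀ k s l → k ≤ l → take k (slice f s l) ≡ slice f s k
  take-slice zero    s l       _        = refl
  take-slice (suc k) s (suc l) (s≤s k≤) = cong (f s ∷_) (take-slice k (suc s) l k≤)

  slice-++ : ∀ s k l → slice f s (k + l) ≡ slice f s k ++ slice f (s + k) l
  slice-++ s zero    l rewrite +-identityʳ s = refl
  slice-++ s (suc k) l rewrite +-suc s k = cong (f s ∷_) (slice-++ (suc s) k l)

  slice-const : ∀ {x} s l → (∀ e → e < l → f (s + e) ≡ x) → slice f s l ≡ replicate l x
  slice-const s zero    _     = refl
  slice-const s (suc l) const = cong₂ _∷_
    (trans (cong f (sym (+-identityʳ s))) (const 0 z<s))
    (slice-const (suc s) l λ e e<l → trans (cong f (sym (+-suc s e))) (const (suc e) (s<s e<l)))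

  slice-≡-++-∷ : ∀ s l (u : List A) x v → slice f s l ≡ u ++ x ∷ v → f (s + length u) ≡ x × length u < l
  slice-≡-++-∷ s (suc l) []      x v eq rewrite +-identityʳ s = ∷-injectiveˡ eq , z<s
  slice-≡-++-∷ s (suc l) (y ∷ u) x v eq with slice-≡-++-∷ (suc s) l u x v (∷-injectiveʳ eq)
  ... | fx , u<l rewrite +-suc s (length u) = fx , s<s u<l

  slice-occurs : ∀ {s l t k} → s ≤ t → t + k ≤ s + l → Occurs (slice f t k) (slice f s l)
  slice-occurs {s} {l} {t} {k} s≤t t+k≤s+l
    with i , refl ← m≤n⇒∃[o]m+o≡n s≤t
    with j , t+k+j≡s+l ← m≤n⇒∃[o]m+o≡n t+k≤s+l =
    subst (Occurs (slice f (s + i) k) ∘′ slice f s) i+k+j≡l (slice f s i , slice f (s + i + k) j , split)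
    where
    i+k+j≡l : i + (k + j) ≡ l
    i+k+j≡l = +-cancelˡ-≡ s _ _ (begin
      s + (i + (k + j)) ≡⟨ +-assoc s i (k + j) ⟨
      s + i + (k + j)   ≡⟨ +-assoc (s + i) k j ⟨
      s + i + k + j     ≡⟨ t+k+j≡s+l ⟩
      s + l             ∎)
      where open ≡-Reasoning
    split : slice f s (i + (k + j)) ≡ slice f s i ++ slice f (s + i) k ++ slice f (s + i + k) j
    split = trans (slice-++ s i (k + j)) (cong (slice f s i ++_) (slice-++ (s + i) k j))

  ∷ʳ-occurs-slice⇒position : ∀ s l (u : List A) x → Occurs (u ++ [ x ]) (slice f s l) →
                             ∃ λ t → s + length u ≤ t × t < s + l × f t ≡ x
  ∷ʳ-occurs-slice⇒position s l u x (p , q , eq) =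
    s + length (p ++ u) , +-monoʳ-≤ s (length-++-≤ʳ u {p}) , +-monoʳ-< s (proj₂ at) , proj₁ at
    where
    at : f (s + length (p ++ u)) ≡ x × length (p ++ u) < l
    at = slice-≡-++-∷ s l (p ++ u) x q
           (trans eq (trans (cong (p ++_) (++-assoc u [ x ] q)) (sym (++-assoc p u (x ∷ q)))))

%≡%∧/<⇒+≤ : ∀ {a b n} .{{_ : NonZero n}} → a % n ≡ b % n → a / n < b / n → a + n ≤ b
%≡%∧/<⇒+≤ {a} {b} {n} a%≡b% a/<b/ = begin
  a + n                   ≡⟨ cong (_+ n) (m≡m%n+[m/n]*n a n) ⟩
  a % n + a / n * n + n   ≡⟨ +-assoc (a % n) _ n ⟩
  a % n + (a / n * n + n) ≡⟨ cong (a % n +_) (+-comm (a / n * n) n) ⟩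
  a % n + suc (a / n) * n ≡⟨ cong (_+ suc (a / n) * n) a%≡b% ⟩
  b % n + suc (a / n) * n ≤⟨ +-monoʳ-≤ (b % n) (*-monoˡ-≤ n a/<b/) ⟩
  b % n + b / n * n       ≡⟨ m≡m%n+[m/n]*n b n ⟨
  b                       ∎
  where open ≤-Reasoning

%≡%⇒≡ : ∀ {a b n} .{{_ : NonZero n}} → a ≤ b → b < a + n → a % n ≡ b % n → a ≡ b
%≡%⇒≡ {a} {b} {n} a≤b b<a+n a%≡b% with <-cmp (a / n) (b / n)
... | tri< a/<b/ _ _ = contradiction (%≡%∧/<⇒+≤ a%≡b% a/<b/) (<⇒≱ b<a+n)
... | tri> _ _ b/<a/ = contradiction (%≡%∧/<⇒+≤ (sym a%≡b%) b/<a/) (<⇒≱ (≤-<-trans a≤b (m<m+n b 0<n)))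
  where 0<n = >-nonZero⁻¹ n
... | tri≈ _ a/≡b/ _ = begin
  a                 ≡⟨ m≡m%n+[m/n]*n a n ⟩
  a % n + a / n * n ≡⟨ cong₂ (λ x y → x + y * n) a%≡b% a/≡b/ ⟩
  b % n + b / n * n ≡⟨ m≡m%n+[m/n]*n b n ⟨
  b                 ∎
  where open ≡-Reasoning

∤-before-multiple : ∀ {K u δ} Q .{{_ : NonZero δ}} → δ < K → u + δ ≡ Q * K → ¬ K ∣ u
∤-before-multiple {K} Q δ<K eq K∣u = >⇒∤ δ<K (∣m+n∣m⇒∣n (subst (K ∣_) (sym eq) (n∣m*n Q)) K∣u)

∤-after-multiple : ∀ {K δ} Q .{{_ : NonZero δ}} → δ < K → ¬ K ∣ Q * K + δ
∤-after-multiple Q δ<K K∣ = >⇒∤ δ<K (∣m+n∣m⇒∣n K∣ (n∣m*n Q))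

-- The infinite text: position Q K carries the letter 1 + (Q mod m), every other position
-- the filler letter 0.  Each window of length d ≤ m K thus sees every letter at most once.
module Marker (m K : ℕ) .{{_ : NonZero m}} .{{_ : NonZero K}} where

  letter : ℕ → Fin (suc m)
  letter Q = Fin.suc (Q mod m)

  marker : ℕ → Fin (suc m)
  marker u with K ∣? u
  ... | yes _ = letter (u / K)
  ... | no  _ = Fin.zero

  letter≡⇒%≡ : ∀ {P Q} → letter P ≡ letter Q → P % m ≡ Q % m
  letter≡⇒%≡ eq = trans (sym (toℕ-fromℕ< _)) (trans (cong toℕ (fsuc-injective eq)) (toℕ-fromℕ< _))

  marker-multiple : ∀ Q → marker (Q * K) ≡ letter Q
  marker-multiple Q with K ∣? Q * K
  ... | yes _ = cong letter (m*n/n≡m Q K)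
  ... | no K∤ = contradiction (n∣m*n Q) K∤

  marker-∤ : ∀ {u} → ¬ K ∣ u → marker u ≡ Fin.zero
  marker-∤ {u} K∤u with K ∣? u
  ... | yes K∣u = contradiction K∣u K∤u
  ... | no  _   = refl

  marker-unique : ∀ {t} Q → Q * K < t + K → t < (Q + m) * K → marker t ≡ letter Q → t ≡ Q * K
  marker-unique {t} Q QK<t+K t<[Q+m]K eq with K ∣? t
  ... | no  _   with () ← eq
  ... | yes K∣t = begin
    t     ≡⟨ q*K≡t ⟨
    q * K ≡⟨ cong (_* K) (%≡%⇒≡ Q≤q q<Q+m (sym (letter≡⇒%≡ eq))) ⟨
    Q * K ∎
    where
    open ≡-Reasoning
    q = t / K
    q*K≡t : q * K ≡ t
    q*K≡t = m/n*n≡m K∣t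
    Q≤q : Q ≤ q
    Q≤q = ≤-pred (*-cancelʳ-< _ Q (suc q)
            (subst (Q * K <_) (trans (cong (_+ K) (sym q*K≡t)) (+-comm (q * K) K)) QK<t+K))
    q<Q+m : q < Q + m
    q<Q+m = *-cancelʳ-< _ q (Q + m) (subst (_< (Q + m) * K) (sym q*K≡t) t<[Q+m]K)

  marker-after-multiple : ∀ P {e} → suc e < K → marker (P * K + suc e) ≡ Fin.zero
  marker-after-multiple P e<K = marker-∤ (∤-after-multiple P e<K)

  slice-after-multiple : ∀ P l → l < K → slice marker (suc (P * K)) l ≡ replicate l Fin.zero
  slice-after-multiple P l l<K = slice-const marker (suc (P * K)) l λ e e<l →
    trans (cong marker (sym (+-suc (P * K) e))) (marker-after-multiple P (≤-<-trans e<l l<K))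

  -- x and y are the windows T[A .. A+d-1] and T[A+1 .. A+d]; the first marker of x is at Q K.
  module Window {A Q r d : ℕ} (A+1+r≡QK : A + suc r ≡ Q * K)
                (2[1+r]≤K : 2 * suc r ≤ K) (K≤d : K ≤ d) (d≤mK : d ≤ m * K) where

    c : Fin (suc m)
    c = letter Q

    x y : Word (suc m)
    x = slice marker A d
    y = slice marker (suc A) d

    Z : Word (suc m)
    Z = replicate (suc r) Fin.zero ++ [ c ]

    witness : ℕ → Word (suc m)
    witness i = letter (Q + i) ∷ Z

    [1+r]+[1+r]≤K : suc r + suc r ≤ K
    [1+r]+[1+r]≤K = subst (_≤ K) (cong (suc r +_) (+-identityʳ (suc r))) 2[1+r]≤K

    1+r<K : suc r < K
    1+r<K = <-≤-trans (m<m+n (suc r) z<s) [1+r]+[1+r]≤K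

    A<QK : A < Q * K
    A<QK = subst (A <_) A+1+r≡QK (m<m+n A z<s)

    marker-QK : marker (A + suc r) ≡ c
    marker-QK = trans (cong marker A+1+r≡QK) (marker-multiple Q)

    marker-before-QK : ∀ {u} → A ≤ u → u < Q * K → marker u ≡ Fin.zero
    marker-before-QK {u} A≤u u<QK =
      marker-∤ (∤-before-multiple Q {{>-nonZero (m<n⇒0<n∸m u<QK)}} δ<K (m+[n∸m]≡n (<⇒≤ u<QK)))
      where
      δ<K : Q * K ∸ u < K
      δ<K = begin-strict
        Q * K ∸ u ≤⟨ ∸-monoʳ-≤ (Q * K) A≤u ⟩
        Q * K ∸ A ≡⟨ cong (_∸ A) A+1+r≡QK ⟨
        A + suc r ∸ A ≡⟨ m+n∸m≡n A (suc r) ⟩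
        suc r <⟨ 1+r<K ⟩
        K ∎
        where open ≤-Reasoning

    slice-before-QK : ∀ s l → A ≤ s → s + l ≤ Q * K → slice marker s l ≡ replicate l Fin.zero
    slice-before-QK s l A≤s s+l≤QK = slice-const marker s l λ e e<l →
      marker-before-QK (≤-trans A≤s (m≤m+n s e)) (<-≤-trans (+-monoʳ-< s e<l) s+l≤QK)

    [1+r]+[1+r]≤d : suc r + suc r ≤ d
    [1+r]+[1+r]≤d = ≤-trans [1+r]+[1+r]≤K K≤d

    [1+r]+1≤d : suc r + 1 ≤ d
    [1+r]+1≤d = ≤-trans (+-monoʳ-≤ (suc r) (s≤s z≤n)) [1+r]+[1+r]≤d

    QK+1+r≤A+d : Q * K + suc r ≤ A + d
    QK+1+r≤A+d = begin
      Q * K + suc r       ≡⟨ cong (_+ suc r) A+1+r≡QK ⟨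
      A + suc r + suc r   ≡⟨ +-assoc A (suc r) (suc r) ⟩
      A + (suc r + suc r) ≤⟨ +-monoʳ-≤ A [1+r]+[1+r]≤d ⟩
      A + d               ∎
      where open ≤-Reasoning

    Z-occurs-x : Occurs Z x
    Z-occurs-x = subst (λ w → Occurs w x) Z-slice
      (slice-occurs marker ≤-refl (+-monoʳ-≤ A [1+r]+1≤d))
      where
      Z-slice : slice marker A (suc r + 1) ≡ Z
      Z-slice = trans (slice-++ marker A (suc r) 1)
        (cong₂ _++_ (slice-before-QK A (suc r) ≤-refl (≤-reflexive A+1+r≡QK)) (cong [_] marker-QK))

    zeros-occurs-y : Occurs (replicate (suc r) Fin.zero) y
    zeros-occurs-y = subst (λ w → Occurs w y) (slice-after-multiple Q (suc r) 1+r<K)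
      (slice-occurs marker (s≤s (<⇒≤ A<QK)) (s≤s QK+1+r≤A+d))

    zeros-c-occurs-y : Occurs (replicate r Fin.zero ++ [ c ]) y
    zeros-c-occurs-y = subst (λ w → Occurs w y) zeros-c-slice
      (slice-occurs marker ≤-refl (+-monoʳ-≤ (suc A) (≤-trans (n≤1+n (r + 1)) [1+r]+1≤d)))
      where
      1+A+r≡A+1+r : suc A + r ≡ A + suc r
      1+A+r≡A+1+r = sym (+-suc A r)
      zeros-c-slice : slice marker (suc A) (r + 1) ≡ replicate r Fin.zero ++ [ c ]
      zeros-c-slice = trans (slice-++ marker (suc A) r 1)
        (cong₂ _++_ (slice-before-QK (suc A) r (n≤1+n A) (≤-reflexive (trans 1+A+r≡A+1+r A+1+r≡QK)))
                    (cong [_] (trans (cong marker 1+A+r≡A+1+r) marker-QK)))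

    letter-zeros-occurs-x : ∀ P → Q ≤ P → P * K + suc (suc r) ≤ A + d →
                            Occurs (letter P ∷ replicate (suc r) Fin.zero) x
    letter-zeros-occurs-x P Q≤P fits = subst (λ w → Occurs w x)
      (cong₂ _∷_ (marker-multiple P) (slice-after-multiple P (suc r) 1+r<K))
      (slice-occurs marker (≤-trans (<⇒≤ A<QK) (*-monoˡ-≤ K Q≤P)) fits)

    c-absent : ∀ s l (u : Word (suc m)) → A ≤ s → s + l ≤ suc (A + d) → Q * K < s + length u →
               ¬ Occurs (u ++ [ c ]) (slice marker s l)
    c-absent s l u A≤s s+l≤1+A+d QK<s+u occ
      with t , s+u≤t , t<s+l , marker-t ← ∷ʳ-occurs-slice⇒position marker s l u c occ =
      <⇒≢ (<-≤-trans QK<s+u s+u≤t) (sym (marker-unique Q QK<t+K t<[Q+m]K marker-t))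
      where
      QK<t+K : Q * K < t + K
      QK<t+K = <-≤-trans (<-≤-trans QK<s+u s+u≤t) (m≤m+n t K)
      t<[Q+m]K : t < (Q + m) * K
      t<[Q+m]K = begin-strict
        t             <⟨ <-≤-trans t<s+l s+l≤1+A+d ⟩
        suc (A + d)   ≤⟨ +-monoˡ-≤ d A<QK ⟩
        Q * K + d     ≤⟨ +-monoʳ-≤ (Q * K) d≤mK ⟩
        Q * K + m * K ≡⟨ *-distribʳ-+ K Q m ⟨
        (Q + m) * K   ∎
        where open ≤-Reasoning

    length-Z : length Z ≡ suc r + 1
    length-Z = trans (length-++ (replicate (suc r) Fin.zero)) (cong (_+ 1) (length-replicate (suc r)))

    Z-absent-y : ¬ Occurs Z y
    Z-absent-y = c-absent (suc A) d (replicate (suc r) Fin.zero) (n≤1+n A) ≤-refl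
      (subst (λ k → Q * K < suc A + k) (sym (length-replicate (suc r))) (≤-reflexive (cong suc (sym A+1+r≡QK))))

    witness-absent-x : ∀ i → ¬ Occurs (witness i) x
    witness-absent-x i = c-absent A d (letter (Q + i) ∷ replicate (suc r) Fin.zero) ≤-refl (n≤1+n _)
      (subst (λ k → Q * K < A + suc k) (sym (length-replicate (suc r)))
        (subst (_< A + suc (suc r)) A+1+r≡QK (+-monoʳ-< A (n<1+n (suc r)))))

    Z-MAW-y : isMAW Z y ≡ true
    Z-MAW-y = isMAW-intro Fin.zero (replicate r Fin.zero) c y Z-absent-y zeros-occurs-y zeros-c-occurs-y

    Z-not-MAW-x : isMAW Z x ≡ false
    Z-not-MAW-x = isMAW-present Z x Z-occurs-x

    witness-MAW-x : ∀ i → (Q + i) * K + suc (suc r) ≤ A + d → isMAW (witness i) x ≡ true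
    witness-MAW-x i fits = isMAW-intro (letter (Q + i)) (replicate (suc r) Fin.zero) c x (witness-absent-x i)
      (letter-zeros-occurs-x (Q + i) (m≤m+n Q i) fits) Z-occurs-x

    witness-not-MAW-y : ∀ i → isMAW (witness i) y ≡ false
    witness-not-MAW-y i = isMAW-absent-tail (letter (Q + i)) Z y Z-absent-y

    symDiffMAW-window : ∀ I → I * K < d → suc I ≤ symDiffMAW x y
    symDiffMAW-window I IK<d = subst (_≤ symDiffMAW x y) (cong suc (length-applyUpTo witness I))
      (symDiffMAW-≥ x y unique short differ)
      where
      I<m : I < m
      I<m = *-cancelʳ-< K I m (<-≤-trans IK<d d≤mK)

      fits : ∀ {i} → i < I → (Q + i) * K + suc (suc r) ≤ A + d
      fits {i} i<I = begin
        (Q + i) * K + suc (suc r)         ≡⟨ cong (_+ suc (suc r)) (*-distribʳ-+ K Q i) ⟩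
        Q * K + i * K + suc (suc r)       ≡⟨ cong (λ z → z + i * K + suc (suc r)) A+1+r≡QK ⟨
        A + suc r + i * K + suc (suc r)   ≡⟨ rearrange A r (i * K) ⟩
        A + suc (i * K + 2 * suc r)       ≤⟨ +-monoʳ-≤ A (s≤s (+-monoʳ-≤ (i * K) 2[1+r]≤K)) ⟩
        A + suc (i * K + K)               ≤⟨ +-monoʳ-≤ A iK+K<d ⟩
        A + d                             ∎
        where
        open ≤-Reasoning
        iK+K<d : i * K + K < d
        iK+K<d = <-≤-trans (s≤s (subst (_≤ I * K) (+-comm K (i * K)) (*-monoˡ-≤ K i<I))) IK<d
        rearrange : ∀ a b c → a + suc b + c + suc (suc b) ≡ a + suc (c + 2 * suc b)
        rearrange = solve-∀

      witness-short : ∀ {i} → length (witness i) ≤ length x + length y + 1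
      witness-short = begin
        suc (length Z)        ≡⟨ cong suc length-Z ⟩
        suc (suc r) + 1       ≤⟨ +-monoˡ-≤ 1 (m<m+n (suc r) z<s) ⟩
        suc r + suc r + 1     ≤⟨ +-monoˡ-≤ 1 (≤-trans [1+r]+[1+r]≤d (m≤m+n d d)) ⟩
        d + d + 1             ≡⟨ cong₂ (λ a b → a + b + 1) (length-slice marker A d) (length-slice marker (suc A) d) ⟨
        length x + length y + 1 ∎
        where open ≤-Reasoning

      short : ∀ {w} → w ∈ Z ∷ applyUpTo witness I → length w ≤ length x + length y + 1
      short (here refl) = ≤-trans (n≤1+n _) (witness-short {0})
      short (there w∈) with i , _ , refl ← ∈-applyUpTo⁻ witness w∈ = witness-short {i}

      differ : ∀ {w} → w ∈ Z ∷ applyUpTo witness I → T (isMAW w x xor isMAW w y)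
      differ (here refl) rewrite Z-not-MAW-x | Z-MAW-y = _
      differ (there w∈) with i , i<I , refl ← ∈-applyUpTo⁻ witness w∈
        rewrite witness-MAW-x i (fits i<I) | witness-not-MAW-y i = _

      unique : Unique (Z ∷ applyUpTo witness I)
      unique = All-applyUpTo⁺₁ witness I (λ _ Z≡w → <⇒≢ (n<1+n _) (cong length Z≡w))
             ∷ Unique-applyUpTo⁺₁ witness I distinct
        where
        distinct : ∀ {i j} → i < j → j < I → witness i ≢ witness j
        distinct {i} {j} i<j j<I wᵢ≡wⱼ =
          <⇒≢ i<j (+-cancelˡ-≡ Q i j (%≡%⇒≡ Q+i≤Q+j Q+j<Q+i+m (letter≡⇒%≡ (∷-injectiveˡ wᵢ≡wⱼ))))
          where
          Q+i≤Q+j : Q + i ≤ Q + j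
          Q+i≤Q+j = +-monoʳ-≤ Q (<⇒≤ i<j)
          Q+j<Q+i+m : Q + j < Q + i + m
          Q+j<Q+i+m = <-≤-trans (+-monoʳ-< Q (<-trans j<I I<m)) (+-monoˡ-≤ m (m≤m+n Q i))

sumTo : (ℕ → ℕ) → ℕ → ℕ
sumTo g zero    = 0
sumTo g (suc N) = g 0 + sumTo (g ∘′ suc) N

sum-map-applyUpTo : ∀ (g h : ℕ → ℕ) N → sum (map g (applyUpTo h N)) ≡ sumTo (g ∘′ h) N
sum-map-applyUpTo g h zero    = refl
sum-map-applyUpTo g h (suc N) = cong (g (h 0) +_) (sum-map-applyUpTo g (h ∘′ suc) N)

sumTo-mono-≤ : ∀ {g h} N → (∀ {i} → i < N → g i ≤ h i) → sumTo g N ≤ sumTo h N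
sumTo-mono-≤ zero    _   = z≤n
sumTo-mono-≤ (suc N) g≤h = +-mono-≤ (g≤h z<s) (sumTo-mono-≤ N (g≤h ∘′ s<s))

sumTo-cong : ∀ {g h} N → (∀ i → g i ≡ h i) → sumTo g N ≡ sumTo h N
sumTo-cong zero    _   = refl
sumTo-cong (suc N) g≡h = cong₂ _+_ (g≡h 0) (sumTo-cong N (λ i → g≡h (suc i)))

sumTo-+ : ∀ g M N → sumTo g (M + N) ≡ sumTo g M + sumTo (λ i → g (M + i)) N
sumTo-+ g zero    N = refl
sumTo-+ g (suc M) N = trans (cong (g 0 +_) (sumTo-+ (g ∘′ suc) M N)) (sym (+-assoc (g 0) _ _))

sumTo-const : ∀ {g C} N → (∀ {i} → i < N → g i ≡ C) → sumTo g N ≡ N * C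
sumTo-const zero    _   = refl
sumTo-const (suc N) g≡C = cong₂ _+_ (g≡C z<s) (sumTo-const N (g≡C ∘′ s<s))

sumTo-monoʳ-≤ : ∀ g {M N} → M ≤ N → sumTo g M ≤ sumTo g N
sumTo-monoʳ-≤ g {M} M≤N with k , refl ← m≤n⇒∃[o]m+o≡n M≤N =
  subst (sumTo g M ≤_) (sym (sumTo-+ g M k)) (m≤m+n _ _)

module Density (K h C : ℕ) .{{_ : NonZero K}} (h<K : h < K) (K≤3h : K ≤ 3 * h) where

  weight : ℕ → ℕ
  weight i = if i % K <ᵇ h then C else 0

  weight-initial : ∀ {i} → i < h → weight i ≡ C
  weight-initial {i} i<h rewrite m<n⇒m%n≡m (<-trans i<h h<K) | Equivalence.to T-≡ (<⇒<ᵇ i<h) = refl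

  weight-periodic : ∀ i → weight (K + i) ≡ weight i
  weight-periodic i = cong (λ k → if k <ᵇ h then C else 0) (trans (cong (_% K) (+-comm K i)) ([m+n]%n≡m%n i K))

  h*C≤sum : ∀ {N} → h ≤ N → h * C ≤ sumTo weight N
  h*C≤sum {N} h≤N = subst (_≤ sumTo weight N) (sumTo-const h weight-initial) (sumTo-monoʳ-≤ weight h≤N)

  K*C≤3*sum : ∀ {N} → h ≤ N → K * C ≤ 3 * sumTo weight N
  K*C≤3*sum {N} h≤N = begin
    K * C                  ≤⟨ *-monoˡ-≤ C K≤3h ⟩
    3 * h * C              ≡⟨ *-assoc 3 h C ⟩
    3 * (h * C)            ≤⟨ *-monoʳ-≤ 3 (h*C≤sum h≤N) ⟩
    3 * sumTo weight N     ∎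
    where open ≤-Reasoning

  density : ∀ N → N * C ≤ 3 * sumTo weight N
  density = <-rec _ step
    where
    step : ∀ N → (∀ {N′} → N′ < N → N′ * C ≤ 3 * sumTo weight N′) → N * C ≤ 3 * sumTo weight N
    step N rec with N ≤? h | N <? K
    ... | yes N≤h | _ =
      subst (λ s → N * C ≤ 3 * s) (sym (sumTo-const N λ i<N → weight-initial (<-≤-trans i<N N≤h))) (m≤m+n (N * C) _)
    ... | no N≰h | yes N<K = ≤-trans (*-monoˡ-≤ C (<⇒≤ N<K)) (K*C≤3*sum (<⇒≤ (≰⇒> N≰h)))
    ... | no _   | no N≮K with N′ , refl ← m≤n⇒∃[o]m+o≡n (≮⇒≥ N≮K) = begin
      (K + N′) * C
        ≡⟨ *-distribʳ-+ C K N′ ⟩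
      K * C + N′ * C
        ≤⟨ +-mono-≤ (K*C≤3*sum (<⇒≤ h<K)) (rec (m<n+m N′ (>-nonZero⁻¹ K))) ⟩
      3 * sumTo weight K + 3 * sumTo weight N′
        ≡⟨ *-distribˡ-+ 3 (sumTo weight K) _ ⟨
      3 * (sumTo weight K + sumTo weight N′)
        ≡⟨ cong (λ s → 3 * (sumTo weight K + s)) (sumTo-cong N′ λ i → sym (weight-periodic i)) ⟩
      3 * (sumTo weight K + sumTo (λ i → weight (K + i)) N′)
        ≡⟨ cong (3 *_) (sumTo-+ weight K N′) ⟨
      3 * sumTo weight (K + N′)
        ∎
      where open ≤-Reasoning

⌈_/_⌉ : (n k : ℕ) .{{_ : NonZero k}} → ℕ
⌈ n / k ⌉ = suc ((n ∸ 1) / k)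

⌈/⌉-lower : ∀ n k .{{_ : NonZero n}} .{{_ : NonZero k}} → (⌈ n / k ⌉ ∸ 1) * k < n
⌈/⌉-lower n k = ≤-<-trans (m/n*n≤m (n ∸ 1) k) (≤-reflexive (suc-pred n))

⌈/⌉-upper : ∀ n k .{{_ : NonZero n}} .{{_ : NonZero k}} → n ≤ ⌈ n / k ⌉ * k
⌈/⌉-upper n k = begin
  n                                   ≡⟨ suc-pred n ⟨
  suc (n ∸ 1)                         ≡⟨ cong suc (m≡m%n+[m/n]*n (n ∸ 1) k) ⟩
  suc ((n ∸ 1) % k + (n ∸ 1) / k * k) ≤⟨ +-monoˡ-≤ _ (m%n<n (n ∸ 1) k) ⟩
  k + (n ∸ 1) / k * k                 ∎
  where open ≤-Reasoning

module Construction (m d n : ℕ) .{{_ : NonZero m}} (m<d : m < d) (d<n : d < n) where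

  private instance
    d≢0 : NonZero d
    d≢0 = >-nonZero (<-≤-trans z<s m<d)

  K h C N : ℕ
  K = ⌈ d / m ⌉
  h = K / 2
  C = ⌈ d / K ⌉
  N = n ∸ d

  2≤K : 2 ≤ K
  2≤K = s≤s (m≥n⇒m/n>0 (<⇒≤pred m<d))

  K≤d : K ≤ d
  K≤d = ≤-<-trans (m≤m*n (K ∸ 1) m) (⌈/⌉-lower d m)

  d≤mK : d ≤ m * K
  d≤mK = subst (d ≤_) (*-comm K m) (⌈/⌉-upper d m)

  0<h : 0 < h
  0<h = m≥n⇒m/n>0 2≤K

  2h≤K : 2 * h ≤ K
  2h≤K = subst (_≤ K) (*-comm h 2) (m/n*n≤m K 2)

  h<K : h < K
  h<K = <-≤-trans (subst (h <_) (cong (h +_) (sym (+-identityʳ h))) (m<m+n h 0<h)) 2h≤K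

  K≤3h : K ≤ 3 * h
  K≤3h = begin
    K             ≡⟨ m≡m%n+[m/n]*n K 2 ⟩
    K % 2 + h * 2 ≤⟨ +-monoˡ-≤ (h * 2) (≤-trans (≤-pred (m%n<n K 2)) 0<h) ⟩
    h + h * 2     ≡⟨ cong (h +_) (*-comm h 2) ⟩
    3 * h         ∎
    where open ≤-Reasoning

  m<2C : m < 2 * C
  m<2C = *-cancelʳ-< K m (2 * C) (begin-strict
    m * K               ≡⟨ *-comm m K ⟩
    K * m               ≡⟨ cong (_* m) (suc-pred K) ⟨
    m + (K ∸ 1) * m     <⟨ +-mono-< m<d (⌈/⌉-lower d m) ⟩
    d + d               ≤⟨ +-mono-≤ (⌈/⌉-upper d K) (≤-trans (⌈/⌉-upper d K) (m≤m+n _ 0)) ⟩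
    C * K + (C * K + 0) ≡⟨ *-assoc 2 C K ⟨
    2 * C * K           ∎)
    where open ≤-Reasoning

  open Marker m K
  open Density K h C h<K K≤3h

  text : Word (suc m)
  text = slice marker (K ∸ h) n

  length-text : length text ≡ n
  length-text = length-slice marker (K ∸ h) n

  window-text : ∀ j → j + d ≤ n → window text j d ≡ slice marker (K ∸ h + j) d
  window-text j j+d≤n = trans (cong (take d) (drop-slice marker j (K ∸ h) n))
    (take-slice marker d (K ∸ h + j) (n ∸ j) (subst (_≤ n ∸ j) (m+n∸m≡n j d) (∸-monoˡ-≤ j j+d≤n)))

  F : ℕ → ℕ
  F j = symDiffMAW (window text j d) (window text (suc j) d)

  S≡sumTo : S text d ≡ sumTo F N
  S≡sumTo = trans (cong (λ ℓ → sum (map F (upTo (ℓ ∸ d)))) length-text) (sum-map-applyUpTo F (λ j → j) N)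

  -- For j mod K < h the next marker after position K - h + j is at distance h - (j mod K),
  -- at most K / 2 as the window lemma requires.
  weight≤F : ∀ {j} → j < N → weight j ≤ F j
  weight≤F {j} j<N with j % K <ᵇ h in good
  ... | false = z≤n
  ... | true  = subst₂ (λ u v → C ≤ symDiffMAW u v) (sym (window-text j j+d≤n))
                  (sym (trans (window-text (suc j) 1+j+d≤n) (cong (λ a → slice marker a d) (+-suc (K ∸ h) j))))
                  (Window.symDiffMAW-window {K ∸ h + j} {suc (j / K)} {r} {d} gap 2[1+r]≤K K≤d d≤mK
                    ((d ∸ 1) / K) (⌈/⌉-lower d K))
    where
    s = j % K
    s<h : s < h
    s<h = <ᵇ⇒< s h (subst T (sym good) _)
    r = pred (h ∸ s)
    1+r≡h∸s : suc r ≡ h ∸ s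
    1+r≡h∸s = suc-pred (h ∸ s) {{>-nonZero (m<n⇒0<n∸m s<h)}}
    2[1+r]≤K : 2 * suc r ≤ K
    2[1+r]≤K = ≤-trans (*-monoʳ-≤ 2 (subst (_≤ h) (sym 1+r≡h∸s) (m∸n≤m h s))) 2h≤K
    1+j+d≤n : suc j + d ≤ n
    1+j+d≤n = subst (suc j + d ≤_) (m∸n+n≡m (<⇒≤ d<n)) (+-monoˡ-≤ d j<N)
    j+d≤n : j + d ≤ n
    j+d≤n = ≤-trans (n≤1+n _) 1+j+d≤n
    gap : K ∸ h + j + suc r ≡ suc (j / K) * K
    gap = begin
      K ∸ h + j + suc r                ≡⟨ cong₂ (λ a b → K ∸ h + a + b) (m≡m%n+[m/n]*n j K) 1+r≡h∸s ⟩
      K ∸ h + (s + j / K * K) + (h ∸ s) ≡⟨ rearrange (K ∸ h) s (j / K * K) (h ∸ s) ⟩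
      K ∸ h + (s + (h ∸ s)) + j / K * K ≡⟨ cong (λ a → K ∸ h + a + j / K * K) (m+[n∸m]≡n (<⇒≤ s<h)) ⟩
      K ∸ h + h + j / K * K             ≡⟨ cong (_+ j / K * K) (m∸n+n≡m (<⇒≤ h<K)) ⟩
      K + j / K * K                     ∎
      where
      open ≡-Reasoning
      rearrange : ∀ a b c e → a + (b + c) + e ≡ a + (b + e) + c
      rearrange = solve-∀

  total : N * suc m ≤ 6 * S text d
  total = begin
    N * suc m                ≤⟨ *-monoʳ-≤ N m<2C ⟩
    N * (2 * C)              ≡⟨ rearrange N C ⟩
    2 * (N * C)              ≤⟨ *-monoʳ-≤ 2 (density N) ⟩
    2 * (3 * sumTo weight N) ≤⟨ *-monoʳ-≤ 2 (*-monoʳ-≤ 3 (sumTo-mono-≤ N weight≤F)) ⟩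
    2 * (3 * sumTo F N)      ≡⟨ *-assoc 2 3 (sumTo F N) ⟨
    6 * sumTo F N            ≡⟨ cong (6 *_) S≡sumTo ⟨
    6 * S text d             ∎
    where
    open ≤-Reasoning
    rearrange : ∀ a b → a * (2 * b) ≡ 2 * (a * b)
    rearrange = solve-∀

lemma15 : (p q : ℕ) → 0 < p → 0 < q →
          ∃ λ a → ∃ λ b → ∃ λ N → 0 < a × 0 < b ×
            ((σ d n : ℕ) → 2 ≤ σ → σ ≤ d → 1 ≤ d → N ≤ n → d < n →
              p * n ≤ q * (n ∸ d) →
              ∃ λ (T : List (Fin σ)) → length T ≡ n × a * (σ * n) ≤ b * S T d)
lemma15 p (suc q) 0<p _ = p , 6 * suc q , 0 , 0<p , z<s , construct
  where
  construct : (σ d n : ℕ) → 2 ≤ σ → σ ≤ d → 1 ≤ d → 0 ≤ n → d < n → p * n ≤ suc q * (n ∸ d) →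
              ∃ λ (T : List (Fin σ)) → length T ≡ n × p * (σ * n) ≤ 6 * suc q * S T d
  construct σ@(suc (suc m)) d n (s≤s (s≤s z≤n)) σ≤d _ _ d<n pn≤q[n∸d] = text , length-text , (begin
    p * (σ * n)            ≡⟨ reorder₁ p σ n ⟩
    σ * (p * n)            ≤⟨ *-monoʳ-≤ σ pn≤q[n∸d] ⟩
    σ * (suc q * N)        ≡⟨ reorder₂ σ (suc q) N ⟩
    suc q * (N * σ)        ≤⟨ *-monoʳ-≤ (suc q) total ⟩
    suc q * (6 * S text d) ≡⟨ reorder₃ (suc q) (S text d) ⟩
    6 * suc q * S text d   ∎)
    where
    open Construction (suc m) d n σ≤d d<n
    open ≤-Reasoning
    reorder₁ : ∀ a b c → a * (b * c) ≡ b * (a * c)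
    reorder₁ = solve-∀
    reorder₂ : ∀ a b c → a * (b * c) ≡ b * (c * a)
    reorder₂ = solve-∀
    reorder₃ : ∀ a b → a * (6 * b) ≡ 6 * a * b
    reorder₃ = solve-∀
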